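{- Let $K$ be a finite simplicial complex, let $\overrightarrow{W}$ be a Morse sequence on $K$, and let $\Upsilon$ be its Morse reference. For any $p\ge0$ and any $c,c'\in K[p]$, if $\Upsilon(c)=\Upsilon(c')$ then $\Upsilon(\partial_p(c))=\Upsilon(\partial_p(c'))$.
   Context: A finite simplicial complex $K$ is a finite family of non-empty finite sets such that $\sigma\in K$ whenever $\emptyset\neq\sigma\subseteq\tau$ for some $\tau\in K$; $K^{(p)}$ is the set of $p$-simplexes (sets of $p+1$ elements), and a facet is an inclusion-maximal simplex. For $p\ge -1$, $K[p]$ is the set of all subsets of $K^{(p)}$ (with $K^{(-1)}=\emptyset$), a $\mathbb{Z}_2$-vector space under symmetric difference, the empty chain being $0$. For $\sigma\in K^{(p)}$, $\partial(\sigma)=\{\tau\in K^{(p-1)}:\tau\subset\sigma\}$; $\partial_p:K[p]\to K[p-1]$ is $\partial_p(c)=\sum_{\sigma\in c}\partial(\sigma)$ (mod 2), $\partial_p(\emptyset)=0$. A pair $(\sigma,\tau)$ with $\sigma\in K^{(p)},\tau\in K^{(p+1)}$ is free for $K$ if $\tau$ is the only simplex of $K$ strictly containing $\sigma$; then $K$ is an elementary expansion of $K\setminus\{\sigma,\tau\}$. If $\sigma$ is a facet of $K$, $K$ is an elementary filling of $K\setminus\{\sigma\}$. A Morse sequence on $K$ is a sequence $\langle\emptyset=K_0,\dots,K_k=K\rangle$ where each $K_i$ is an elementary expansion or elementary filling of $K_{i-1}$; a simplex added by a filling is critical, and a free pair $(\sigma,\tau)$ added by an expansion is a regular pair. $\ddot{W}[p]$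 is the set of subsets of the set of critical $p$-simplexes. A Morse frame is a map $\Upsilon$ sending each $\sigma\in K^{(p)}$ to $\Upsilon(\sigma)\in\ddot{W}[p]$, extended to chains by $\Upsilon(c)=\sum_{\sigma\in c}\Upsilon(\sigma)$ (mod 2), $\Upsilon(\emptyset)=0$. The Morse reference $\Upsilon$ is the unique frame with $\Upsilon(\sigma)=\{\sigma\}$ for critical $\sigma$ and, for each regular pair $(\sigma,\tau)$, $\Upsilon(\tau)=0$ and $\Upsilon(\sigma)=\Upsilon(\partial(\tau)\setminus\{\sigma\})$. -}

module Defs where

open import Data.Bool using (Bool; true; false; _∧_; _xor_; not)
open import Data.Nat using (ℕ; zero; suc; _≡ᵇ_)
open import Data.Fin.Subset using (Subset; _⊆_; ∣_∣; Nonempty; inside; outside)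
open import Data.Fin.Subset.Properties using (_⊆?_)
open import Data.Vec using (_∷_; [])
open import Data.Vec.Properties using (≡-dec)
open import Data.List using (List; []; _∷_; map; _++_)
open import Data.List.Membership.Propositional using (_∈_)
open import Data.Product using (_×_)
open import Relation.Nullary using (¬_)
open import Relation.Nullary.Decidable using (⌊_⌋)
open import Relation.Binary.PropositionalEquality using (_≡_; _≢_)
import Data.Bool.Properties as BoolP

-- Vertices are Fin n; a candidate simplex is a Subset n.
-- A "family of simplices" (a complex, a chain, a value of a frame) is
-- represented by its (Boolean) indicator function on Subset n.

Family : ℕ → Set
Family n = Subset n → Bool

allSubsets : (n : ℕ) → List (Subset n)
allSubsets zero    = [] ∷ []
allSubsets (suc n) = map (outside ∷_) (allSubsets n) ++ map (inside ∷_) (allSubsets n)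

xorSum : {A : Set} → List A → (A → Bool) → Bool
xorSum []       f = false
xorSum (a ∷ as) f = f a xor xorSum as f

_==ˢ_ : {n : ℕ} → Subset n → Subset n → Bool
σ ==ˢ τ = ⌊ ≡-dec BoolP._≟_ σ τ ⌋

_⊆ᵇ_ : {n : ℕ} → Subset n → Subset n → Bool
σ ⊆ᵇ τ = ⌊ σ ⊆? τ ⌋

_≐_ : {n : ℕ} → Family n → Family n → Set
_≐_ {n} c d = (ρ : Subset n) → c ρ ≡ d ρ

record IsComplex {n : ℕ} (K : Family n) : Set where
  field
    nonempty : (σ : Subset n) → K σ ≡ true → Nonempty σ
    closed   : (σ τ : Subset n) → K τ ≡ true → Nonempty σ → σ ⊆ τ → K σ ≡ true

_∈_⁽_⁾ : {n : ℕ} → Subset n → Family n → ℕ → Set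
σ ∈ K ⁽ p ⁾ = (K σ ≡ true) × (∣ σ ∣ ≡ suc p)

IsChain : {n : ℕ} → Family n → ℕ → Family n → Set
IsChain {n} K p c = (σ : Subset n) → c σ ≡ true → σ ∈ K ⁽ p ⁾

-- ∂(σ) = { τ ∈ K^(p-1) : τ ⊂ σ }  for σ ∈ K^(p)   (empty when p = 0 since K^(-1) = ∅)
∂ₛ : {n : ℕ} → Family n → Subset n → Family n
∂ₛ K σ τ = K τ ∧ (τ ⊆ᵇ σ) ∧ (suc ∣ τ ∣ ≡ᵇ ∣ σ ∣)

∂ : {n : ℕ} → Family n → Family n → Family n
∂ {n} K c τ = xorSum (allSubsets n) (λ σ → c σ ∧ ∂ₛ K σ τ)

data Step (n : ℕ) : Set where
  fill   : Subset n → Step n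
  expand : Subset n → Subset n → Step n

added : {n : ℕ} → Step n → Family n
added (fill σ)     ρ = ρ ==ˢ σ
added (expand σ τ) ρ = (ρ ==ˢ σ) Data.Bool.∨ (ρ ==ˢ τ)
  where import Data.Bool

_∪ᶠ_ : {n : ℕ} → Family n → Family n → Family n
(A ∪ᶠ B) ρ = A ρ Data.Bool.∨ B ρ
  where import Data.Bool

IsFacet : {n : ℕ} → Family n → Subset n → Set
IsFacet {n} L σ = (L σ ≡ true) × ((ρ : Subset n) → L ρ ≡ true → σ ⊆ ρ → σ ≡ ρ)

IsFreePair : {n : ℕ} → Family n → Subset n → Subset n → Set
IsFreePair {n} L σ τ =
  (L σ ≡ true) × (L τ ≡ true) × (σ ⊆ τ) × (∣ τ ∣ ≡ suc ∣ σ ∣) ×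
  ((ρ : Subset n) → L ρ ≡ true → σ ⊆ ρ → σ ≢ ρ → ρ ≡ τ)

ValidStep : {n : ℕ} → Family n → Step n → Set
ValidStep L (fill σ) =
  IsComplex (L ∪ᶠ added (fill σ)) × (L σ ≡ false) × IsFacet (L ∪ᶠ added (fill σ)) σ
ValidStep L (expand σ τ) =
  IsComplex (L ∪ᶠ added (expand σ τ)) × (L σ ≡ false) × (L τ ≡ false) ×
  IsFreePair (L ∪ᶠ added (expand σ τ)) σ τ

-- MorseSeqTo L ws : ws (most recent step first) is a Morse sequence
-- ⟨∅ = K₀ , … , K_k = L⟩ ending at the complex L.
data MorseSeqTo {n : ℕ} : Family n → List (Step n) → Set where
  start : MorseSeqTo (λ _ → false) []
  step  : {L : Family n} {ws : List (Step n)} (s : Step n) →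
          MorseSeqTo L ws → ValidStep L s → MorseSeqTo (L ∪ᶠ added s) (s ∷ ws)

record MorseSequence {n : ℕ} (K : Family n) : Set where
  field
    steps : List (Step n)
    final : Family n
    seq   : MorseSeqTo final steps
    isK   : final ≐ K

Critical : {n : ℕ} {K : Family n} → MorseSequence K → Subset n → Set
Critical W σ = fill σ ∈ MorseSequence.steps W

RegularPair : {n : ℕ} {K : Family n} → MorseSequence K → Subset n → Subset n → Set
RegularPair W σ τ = expand σ τ ∈ MorseSequence.steps W

-- A frame assigns to each simplex a set of simplexes (its value on
-- simplexes outside K is irrelevant).
Frame : ℕ → Set
Frame n = Subset n → Family n

ext : {n : ℕ} → Frame n → Family n → Family n
ext {n} Υ c ρ = xorSum (allSubsets n) (λ σ → c σ ∧ Υ σ ρ)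

IsMorseFrame : {n : ℕ} {K : Family n} → MorseSequence K → Frame n → Set
IsMorseFrame {n} {K} W Υ =
  (σ : Subset n) → K σ ≡ true → (ρ : Subset n) → Υ σ ρ ≡ true →
  Critical W ρ × (∣ ρ ∣ ≡ ∣ σ ∣)

record IsMorseReference {n : ℕ} {K : Family n} (W : MorseSequence K) (Υ : Frame n) : Set where
  field
    frame    : IsMorseFrame W Υ
    critical : (σ : Subset n) → Critical W σ → Υ σ ≐ (λ ρ → ρ ==ˢ σ)
    regularτ : (σ τ : Subset n) → RegularPair W σ τ → Υ τ ≐ (λ _ → false)
    regularσ : (σ τ : Subset n) → RegularPair W σ τ →
               Υ σ ≐ ext Υ (λ ρ → ∂ₛ K τ ρ ∧ not (ρ ==ˢ σ))

-- Write ∂ᴹ ν := Υ(∂ν).  Along the Morse sequence one shows Υ(∂σ) = ∂ᴹ(Υσ) for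
-- every simplex σ: for a critical σ this is Υσ = {σ}; for a regular pair
-- (σ, τ), Υ(∂τ) = Υσ + Υ(∂τ ∖ σ) = 0 = ∂ᴹ(Υτ), and the simplexes of ∂τ ∖ σ
-- come earlier in the sequence, so
-- ∂ᴹ(Υσ) = ∂ᴹ(Υ(∂τ ∖ σ)) = Υ(∂(∂τ ∖ σ)) = Υ(∂∂τ + ∂σ) = Υ(∂σ).
-- By linearity Υ(∂c) = ∂ᴹ(Υc), which only depends on Υc.
module Submission where

open import Algebra.Bundles using (CommutativeRing)
open import Data.Bool using (Bool; true; false; _∧_; _∨_; _xor_; not)
open import Data.Bool.Properties
  using ( _≟_; T-≡; ∧-zeroʳ; ∧-identityʳ; ∧-assoc; ∧-distribʳ-xor; ∨-identityʳ; ∨-zeroʳ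
        ; xor-identityʳ; xor-same; xor-assoc; not-injective; xor-∧-commutativeRing)
open import Algebra.Properties.CommutativeSemigroup
  (CommutativeRing.+-commutativeSemigroup xor-∧-commutativeRing) using (interchange)
open import Data.Empty using (⊥-elim)
open import Data.Fin.Subset using (Subset; _⊆_; ∣_∣; inside; outside)
open import Data.Fin.Subset.Properties using (_⊆?_)
open import Data.List using (List; []; _∷_; map; _++_)
open import Data.List.Membership.Propositional using (_∈_)
open import Data.List.Relation.Unary.Any using (here; there)
open import Data.Nat using (ℕ; zero; suc; _≡ᵇ_; _≤_; _<_; s≤s)
open import Data.Nat.Properties using (≡ᵇ⇒≡; ≡⇒≡ᵇ; suc-injective; 1+n≢n; ≤-refl; <⇒≤; <-trans; n<1+n)
open import Data.Product using (_×_; _,_; proj₁; proj₂; map₂)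
open import Data.Sum using (_⊎_; inj₁; inj₂)
open import Data.Vec using (_∷_; [])
open import Data.Vec.Properties using (≡-dec)
open import Function using (_∘_)
open import Function.Bundles using (Equivalence)
open import Relation.Nullary using (Dec; does; yes; no; ¬_)
open import Relation.Nullary.Decidable using (⌊_⌋; isYes≗does)
open import Relation.Binary.PropositionalEquality
open ≡-Reasoning

open import Defs

private
  variable
    n : ℕ
    A : Set

⌊⌋≡true⇒ : {a? : Dec A} → ⌊ a? ⌋ ≡ true → A
⌊⌋≡true⇒ {a? = yes a} _ = a

⇒⌊⌋≡true : {a? : Dec A} → A → ⌊ a? ⌋ ≡ true
⇒⌊⌋≡true {a? = yes _} _ = refl
⇒⌊⌋≡true {a? = no ¬a} a = ⊥-elim (¬a a)

⇒⌊⌋≡false : {a? : Dec A} → ¬ A → ⌊ a? ⌋ ≡ false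
⇒⌊⌋≡false {a? = yes a} ¬a = ⊥-elim (¬a a)
⇒⌊⌋≡false {a? = no _}  _  = refl

xor-cancelʳ : ∀ x y → (x xor y) xor y ≡ x
xor-cancelʳ x y = trans (xor-assoc x y y) (trans (cong (x xor_) (xor-same y)) (xor-identityʳ x))

∧≡true⇒ : ∀ {a b} → a ∧ b ≡ true → a ≡ true × b ≡ true
∧≡true⇒ {true} {true} _ = refl , refl

≡ᵇ≡true⇒≡ : ∀ m k → (m ≡ᵇ k) ≡ true → m ≡ k
≡ᵇ≡true⇒≡ m k = ≡ᵇ⇒≡ m k ∘ Equivalence.from T-≡

≡⇒≡ᵇ≡true : ∀ m k → m ≡ k → (m ≡ᵇ k) ≡ true
≡⇒≡ᵇ≡true m k = Equivalence.to T-≡ ∘ ≡⇒≡ᵇ m k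

∷-==ˢ : ∀ x y (ω τ : Subset n) → ((x ∷ ω) ==ˢ (y ∷ τ)) ≡ does (x ≟ y) ∧ (ω ==ˢ τ)
∷-==ˢ x y ω τ =
  trans (isYes≗does _) (cong (does (x ≟ y) ∧_) (sym (isYes≗does (≡-dec _≟_ ω τ))))

∷-⊆ᵇ : ∀ x y (ω τ : Subset n) → ((x ∷ ω) ⊆ᵇ (y ∷ τ)) ≡ (not x ∨ y) ∧ (ω ⊆ᵇ τ)
∷-⊆ᵇ false y     ω τ = trans (isYes≗does _) (sym (isYes≗does (ω ⊆? τ)))
∷-⊆ᵇ true  false ω τ = refl
∷-⊆ᵇ true  true  ω τ = trans (isYes≗does _) (sym (isYes≗does (ω ⊆? τ)))

xorSum-cong : (l : List A) {f g : A → Bool} → (∀ a → f a ≡ g a) → xorSum l f ≡ xorSum l g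
xorSum-cong []      f≗g = refl
xorSum-cong (a ∷ l) f≗g = cong₂ _xor_ (f≗g a) (xorSum-cong l f≗g)

xorSum-false : (l : List A) → xorSum l (λ _ → false) ≡ false
xorSum-false []      = refl
xorSum-false (a ∷ l) = xorSum-false l

xorSum-xor : (l : List A) (f g : A → Bool) →
             xorSum l (λ a → f a xor g a) ≡ xorSum l f xor xorSum l g
xorSum-xor []      f g = refl
xorSum-xor (a ∷ l) f g =
  trans (cong ((f a xor g a) xor_) (xorSum-xor l f g)) (interchange (f a) (g a) _ _)

xorSum-∧ˡ : (l : List A) (b : Bool) (f : A → Bool) → xorSum l (λ a → b ∧ f a) ≡ b ∧ xorSum l f
xorSum-∧ˡ l true  f = refl
xorSum-∧ˡ l false f = xorSum-false l

xorSum-∧ʳ : (l : List A) (b : Bool) (f : A → Bool) → xorSum l (λ a → f a ∧ b) ≡ xorSum l f ∧ b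
xorSum-∧ʳ l true  f = trans (xorSum-cong l (∧-identityʳ ∘ f)) (sym (∧-identityʳ _))
xorSum-∧ʳ l false f =
  trans (xorSum-cong l (∧-zeroʳ ∘ f)) (trans (xorSum-false l) (sym (∧-zeroʳ _)))

xorSum-++ : (l m : List A) (f : A → Bool) → xorSum (l ++ m) f ≡ xorSum l f xor xorSum m f
xorSum-++ []      m f = refl
xorSum-++ (a ∷ l) m f = trans (cong (f a xor_) (xorSum-++ l m f)) (sym (xor-assoc (f a) _ _))

xorSum-map : {B : Set} (l : List A) (g : A → B) (f : B → Bool) →
             xorSum (map g l) f ≡ xorSum l (f ∘ g)
xorSum-map []      g f = refl
xorSum-map (a ∷ l) g f = cong (f (g a) xor_) (xorSum-map l g f)

xorSum-comm : {B : Set} (l : List A) (m : List B) (f : A → B → Bool) →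
              xorSum l (λ a → xorSum m (f a)) ≡ xorSum m (λ b → xorSum l (λ a → f a b))
xorSum-comm []      m f = sym (xorSum-false m)
xorSum-comm (a ∷ l) m f =
  trans (cong (xorSum m (f a) xor_) (xorSum-comm l m f))
        (sym (xorSum-xor m (f a) (λ b → xorSum l (λ a′ → f a′ b))))

xorSum-allSubsets-suc : (f : Subset (suc n) → Bool) →
  xorSum (allSubsets (suc n)) f ≡
  xorSum (allSubsets n) (f ∘ (outside ∷_)) xor xorSum (allSubsets n) (f ∘ (inside ∷_))
xorSum-allSubsets-suc {n} f =
  trans (xorSum-++ (map (outside ∷_) (allSubsets n)) _ f)
        (cong₂ _xor_ (xorSum-map (allSubsets n) _ f) (xorSum-map (allSubsets n) _ f))

xorSum-allSubsets-==ˢ : (σ : Subset n) (f : Subset n → Bool) →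
                         xorSum (allSubsets n) (λ ρ → (ρ ==ˢ σ) ∧ f ρ) ≡ f σ
xorSum-allSubsets-==ˢ []            f = xor-identityʳ (f [])
xorSum-allSubsets-==ˢ {suc n} (x ∷ σ) f = begin
  xorSum (allSubsets (suc n)) (λ ρ → (ρ ==ˢ (x ∷ σ)) ∧ f ρ)
    ≡⟨ xorSum-allSubsets-suc (λ ρ → (ρ ==ˢ (x ∷ σ)) ∧ f ρ) ⟩
  half false xor half true
    ≡⟨ cong₂ _xor_ (half≡ false) (half≡ true) ⟩
  (does (false ≟ x) ∧ f (false ∷ σ)) xor (does (true ≟ x) ∧ f (true ∷ σ))
    ≡⟨ pick x ⟩
  f (x ∷ σ) ∎
  where
  half : Bool → Bool
  half b = xorSum (allSubsets n) (λ ρ → ((b ∷ ρ) ==ˢ (x ∷ σ)) ∧ f (b ∷ ρ))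
  half≡ : ∀ b → half b ≡ does (b ≟ x) ∧ f (b ∷ σ)
  half≡ b = begin
    half b
      ≡⟨ xorSum-cong (allSubsets n) (λ ρ →
           trans (cong (_∧ f (b ∷ ρ)) (∷-==ˢ b x ρ σ)) (∧-assoc (does (b ≟ x)) _ _)) ⟩
    xorSum (allSubsets n) (λ ρ → does (b ≟ x) ∧ ((ρ ==ˢ σ) ∧ f (b ∷ ρ)))
      ≡⟨ xorSum-∧ˡ (allSubsets n) (does (b ≟ x)) _ ⟩
    does (b ≟ x) ∧ xorSum (allSubsets n) (λ ρ → (ρ ==ˢ σ) ∧ f (b ∷ ρ))
      ≡⟨ cong (does (b ≟ x) ∧_) (xorSum-allSubsets-==ˢ σ (f ∘ (b ∷_))) ⟩
    does (b ≟ x) ∧ f (b ∷ σ) ∎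
  pick : ∀ x → (does (false ≟ x) ∧ f (false ∷ σ)) xor (does (true ≟ x) ∧ f (true ∷ σ)) ≡ f (x ∷ σ)
  pick false = xor-identityʳ _
  pick true  = refl

∅ᶠ : Family n
∅ᶠ _ = false

singleton : Subset n → Family n
singleton σ ρ = ρ ==ˢ σ

infixl 30 _⊕ᶠ_
infix 35 _∖ᶠ_

_⊕ᶠ_ : Family n → Family n → Family n
(c ⊕ᶠ d) ρ = c ρ xor d ρ

_∖ᶠ_ : Family n → Subset n → Family n
(c ∖ᶠ σ) ρ = c ρ ∧ not (ρ ==ˢ σ)

_⊆ᶠ_ : Family n → Family n → Set
c ⊆ᶠ d = ∀ ρ → c ρ ≡ true → d ρ ≡ true

c≐c∖ᶠσ⊕ᶠσ : {c : Family n} {σ : Subset n} → c σ ≡ true → c ≐ c ∖ᶠ σ ⊕ᶠ singleton σ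
c≐c∖ᶠσ⊕ᶠσ {c = c} {σ} σ∈c ρ with ρ ==ˢ σ in ρ=σ
... | true  rewrite ⌊⌋≡true⇒ {a? = ≡-dec _≟_ ρ σ} ρ=σ | σ∈c = refl
... | false = sym (trans (xor-identityʳ _) (∧-identityʳ _))

ext-cong : (Υ : Frame n) {c d : Family n} → c ≐ d → ext Υ c ≐ ext Υ d
ext-cong {n} Υ c≐d ρ = xorSum-cong (allSubsets n) (λ σ → cong (_∧ Υ σ ρ) (c≐d σ))

ext-cong-on : {Υ Φ : Frame n} (c : Family n) → (∀ σ → c σ ≡ true → Υ σ ≐ Φ σ) →
              ext Υ c ≐ ext Φ c
ext-cong-on {n} {Υ} {Φ} c Υ≐Φ ρ = xorSum-cong (allSubsets n) agree
  where
  agree : ∀ σ → c σ ∧ Υ σ ρ ≡ c σ ∧ Φ σ ρ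
  agree σ with c σ in σ∈c
  ... | false = refl
  ... | true  = Υ≐Φ σ σ∈c ρ

ext-∘ : (Υ Φ : Frame n) (c : Family n) → ext Φ (ext Υ c) ≐ ext (ext Φ ∘ Υ) c
ext-∘ {n} Υ Φ c ρ = begin
  xorSum S (λ τ → xorSum S (λ σ → c σ ∧ Υ σ τ) ∧ Φ τ ρ)
    ≡⟨ xorSum-cong S (λ τ → sym (xorSum-∧ʳ S (Φ τ ρ) (λ σ → c σ ∧ Υ σ τ))) ⟩
  xorSum S (λ τ → xorSum S (λ σ → (c σ ∧ Υ σ τ) ∧ Φ τ ρ))
    ≡⟨ xorSum-comm S S (λ τ σ → (c σ ∧ Υ σ τ) ∧ Φ τ ρ) ⟩
  xorSum S (λ σ → xorSum S (λ τ → (c σ ∧ Υ σ τ) ∧ Φ τ ρ))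
    ≡⟨ xorSum-cong S (λ σ → trans (xorSum-cong S (λ τ → ∧-assoc (c σ) (Υ σ τ) (Φ τ ρ)))
                                  (xorSum-∧ˡ S (c σ) (λ τ → Υ σ τ ∧ Φ τ ρ))) ⟩
  xorSum S (λ σ → c σ ∧ ext Φ (Υ σ) ρ) ∎
  where S = allSubsets n

ext-⊕ : (Υ : Frame n) (c d : Family n) → ext Υ (c ⊕ᶠ d) ≐ ext Υ c ⊕ᶠ ext Υ d
ext-⊕ {n} Υ c d ρ =
  trans (xorSum-cong (allSubsets n) (λ σ → ∧-distribʳ-xor (Υ σ ρ) (c σ) (d σ)))
        (xorSum-xor (allSubsets n) _ _)

ext-∅ : (Υ : Frame n) → ext Υ ∅ᶠ ≐ ∅ᶠ
ext-∅ {n} Υ ρ = xorSum-false (allSubsets n)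

ext-singleton : (Υ : Frame n) (σ : Subset n) → ext Υ (singleton σ) ≐ Υ σ
ext-singleton Υ σ ρ = xorSum-allSubsets-==ˢ σ (λ τ → Υ τ ρ)

layer : Subset n → Subset n → ℕ → Family n
layer ω τ m ρ = (ω ⊆ᵇ ρ) ∧ ((ρ ⊆ᵇ τ) ∧ (m ≡ᵇ ∣ ρ ∣))

-- layerParity ω τ m is the parity of the number of ρ with ω ⊆ ρ ⊆ τ and ∣ ρ ∣ = m
-- (xorSum-layer); it is computed by Pascal's rule on the first vertex.
layerParity      : Subset n → Subset n → ℕ → Bool
lowerLayerParity : Subset n → Subset n → ℕ → Bool
layerParity []      []      m = m ≡ᵇ 0
layerParity (x ∷ ω) (y ∷ τ) m = (not x ∧ layerParity ω τ m) xor (y ∧ lowerLayerParity ω τ m)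
lowerLayerParity ω τ zero    = false
lowerLayerParity ω τ (suc m) = layerParity ω τ m

xorSum-layer : (ω τ : Subset n) (m : ℕ) → xorSum (allSubsets n) (layer ω τ m) ≡ layerParity ω τ m
xorSum-layer []      []      zero    = refl
xorSum-layer []      []      (suc m) = refl
xorSum-layer {suc n} (x ∷ ω) (y ∷ τ) m =
  trans (xorSum-allSubsets-suc (layer (x ∷ ω) (y ∷ τ) m))
        (cong₂ _xor_ (outside-half x) inside-half)
  where
  S = allSubsets n
  outside-half : ∀ x → xorSum S (layer (x ∷ ω) (y ∷ τ) m ∘ (outside ∷_)) ≡ not x ∧ layerParity ω τ m
  outside-half false =
    trans (xorSum-cong S (λ ρ → cong₂ (λ a b → a ∧ (b ∧ (m ≡ᵇ ∣ ρ ∣)))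
                                     (∷-⊆ᵇ false false ω ρ) (∷-⊆ᵇ false y ρ τ)))
          (xorSum-layer ω τ m)
  outside-half true = xorSum-false S
  inside-half : xorSum S (layer (x ∷ ω) (y ∷ τ) m ∘ (inside ∷_)) ≡ y ∧ lowerLayerParity ω τ m
  inside-half =
    trans (xorSum-cong S (λ ρ → cong₂ (λ a b → a ∧ (b ∧ (m ≡ᵇ suc ∣ ρ ∣)))
                                     (trans (∷-⊆ᵇ x true ω ρ) (cong (_∧ (ω ⊆ᵇ ρ)) (∨-zeroʳ (not x))))
                                     (∷-⊆ᵇ true y ρ τ)))
          (shift y m)
    where
    shift : ∀ y m → xorSum S (λ ρ → (ω ⊆ᵇ ρ) ∧ ((y ∧ (ρ ⊆ᵇ τ)) ∧ (m ≡ᵇ suc ∣ ρ ∣)))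
                    ≡ y ∧ lowerLayerParity ω τ m
    shift false m       = trans (xorSum-cong S (∧-zeroʳ ∘ (ω ⊆ᵇ_))) (xorSum-false S)
    shift true  zero    =
      trans (xorSum-cong S (λ ρ → trans (cong ((ω ⊆ᵇ ρ) ∧_) (∧-zeroʳ (ρ ⊆ᵇ τ))) (∧-zeroʳ _)))
            (xorSum-false S)
    shift true  (suc m) = xorSum-layer ω τ m

layerParity-below      : (ω τ : Subset n) (k : ℕ) → k < ∣ ω ∣ → layerParity ω τ k ≡ false
lowerLayerParity-below : (ω τ : Subset n) (k : ℕ) → k ≤ ∣ ω ∣ → lowerLayerParity ω τ k ≡ false
layerParity-below (false ∷ ω) (y ∷ τ) k k<∣ω∣ =
  cong₂ _xor_ (layerParity-below ω τ k k<∣ω∣)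
              (trans (cong (y ∧_) (lowerLayerParity-below ω τ k (<⇒≤ k<∣ω∣))) (∧-zeroʳ y))
layerParity-below (true ∷ ω) (y ∷ τ) k (s≤s k≤∣ω∣) =
  trans (cong (y ∧_) (lowerLayerParity-below ω τ k k≤∣ω∣)) (∧-zeroʳ y)
lowerLayerParity-below ω τ zero    _   = refl
lowerLayerParity-below ω τ (suc k) k<∣ω∣ = layerParity-below ω τ k k<∣ω∣

layerParity-above      : (ω τ : Subset n) (k : ℕ) → ∣ τ ∣ < k → layerParity ω τ k ≡ false
lowerLayerParity-above : (ω τ : Subset n) (k : ℕ) → suc ∣ τ ∣ < k → lowerLayerParity ω τ k ≡ false
layerParity-above []      []          (suc k) _ = refl
layerParity-above (x ∷ ω) (false ∷ τ) k ∣τ∣<k =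
  trans (xor-identityʳ _) (trans (cong (not x ∧_) (layerParity-above ω τ k ∣τ∣<k)) (∧-zeroʳ (not x)))
layerParity-above (x ∷ ω) (true ∷ τ) k ∣τ∣<k =
  cong₂ _xor_ (trans (cong (not x ∧_) (layerParity-above ω τ k (<-trans (n<1+n _) ∣τ∣<k)))
                     (∧-zeroʳ (not x)))
              (lowerLayerParity-above ω τ k ∣τ∣<k)
lowerLayerParity-above ω τ (suc k) (s≤s ∣τ∣<k) = layerParity-above ω τ k ∣τ∣<k

layerParity-bottom : (ω τ : Subset n) → layerParity ω τ ∣ ω ∣ ≡ ω ⊆ᵇ τ
layerParity-bottom []          []      = refl
layerParity-bottom (false ∷ ω) (y ∷ τ) =
  trans (cong₂ _xor_ (layerParity-bottom ω τ)
                     (trans (cong (y ∧_) (lowerLayerParity-below ω τ ∣ ω ∣ ≤-refl)) (∧-zeroʳ y)))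
        (trans (xor-identityʳ _) (sym (∷-⊆ᵇ false y ω τ)))
layerParity-bottom (true ∷ ω)  (y ∷ τ) =
  trans (cong (y ∧_) (layerParity-bottom ω τ)) (sym (∷-⊆ᵇ true y ω τ))

layerParity-top : (ω τ : Subset n) → layerParity ω τ ∣ τ ∣ ≡ ω ⊆ᵇ τ
layerParity-top []      []          = refl
layerParity-top (x ∷ ω) (false ∷ τ) =
  trans (xor-identityʳ _)
        (trans (cong (not x ∧_) (layerParity-top ω τ))
               (sym (trans (∷-⊆ᵇ x false ω τ) (cong (_∧ (ω ⊆ᵇ τ)) (∨-identityʳ (not x))))))
layerParity-top (x ∷ ω) (true ∷ τ) =
  trans (cong₂ _xor_ (trans (cong (not x ∧_) (layerParity-above ω τ _ (n<1+n _))) (∧-zeroʳ (not x)))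
                     (layerParity-top ω τ))
        (sym (trans (∷-⊆ᵇ x true ω τ) (cong (_∧ (ω ⊆ᵇ τ)) (∨-zeroʳ (not x)))))

-- For ∣ τ ∣ = ∣ ω ∣ + 2, either ω ⊈ τ or exactly two sets of size ∣ ω ∣ + 1 lie between ω and τ.
layerParity-middle : (ω τ : Subset n) → ∣ τ ∣ ≡ suc (suc ∣ ω ∣) → layerParity ω τ (suc ∣ ω ∣) ≡ false
layerParity-middle (false ∷ ω) (false ∷ τ) ∣τ∣≡ =
  trans (xor-identityʳ _) (layerParity-middle ω τ ∣τ∣≡)
layerParity-middle (false ∷ ω) (true ∷ τ) ∣τ∣≡ = begin
  layerParity ω τ (suc ∣ ω ∣) xor layerParity ω τ ∣ ω ∣
    ≡⟨ cong (_xor layerParity ω τ ∣ ω ∣) (cong (layerParity ω τ) (sym (suc-injective ∣τ∣≡))) ⟩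
  layerParity ω τ ∣ τ ∣ xor layerParity ω τ ∣ ω ∣
    ≡⟨ cong₂ _xor_ (layerParity-top ω τ) (layerParity-bottom ω τ) ⟩
  (ω ⊆ᵇ τ) xor (ω ⊆ᵇ τ)
    ≡⟨ xor-same (ω ⊆ᵇ τ) ⟩
  false ∎
layerParity-middle (true ∷ ω) (false ∷ τ) _    = refl
layerParity-middle (true ∷ ω) (true ∷ τ) ∣τ∣≡ = layerParity-middle ω τ (suc-injective ∣τ∣≡)

∂ₛ-∂ₛ : {K : Family n} → IsComplex K → {τ : Subset n} → K τ ≡ true → (ρ ω : Subset n) →
        ∂ₛ K τ ρ ∧ ∂ₛ K ρ ω ≡ K ω ∧ (layer ω τ (suc ∣ ω ∣) ρ ∧ (suc (suc ∣ ω ∣) ≡ᵇ ∣ τ ∣))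
∂ₛ-∂ₛ {K = K} K-complex {τ} Kτ ρ ω
  with K ω in Kω | ω ⊆ᵇ ρ in ω⊆ρ | ρ ⊆ᵇ τ in ρ⊆τ | suc ∣ ω ∣ ≡ᵇ ∣ ρ ∣ in ∣ρ∣≡
... | false | _     | _     | _     = ∧-zeroʳ _
... | true  | false | _     | _     = ∧-zeroʳ _
... | true  | true  | false | _     = cong (_∧ _) (∧-zeroʳ (K ρ))
... | true  | true  | true  | false = ∧-zeroʳ _
... | true  | true  | true  | true
  rewrite IsComplex.closed K-complex ρ τ Kτ
            (map₂ (⌊⌋≡true⇒ ω⊆ρ) (IsComplex.nonempty K-complex ω Kω)) (⌊⌋≡true⇒ ρ⊆τ)
  = trans (∧-identityʳ _) (cong (λ k → suc k ≡ᵇ ∣ τ ∣) (sym (≡ᵇ≡true⇒≡ _ _ ∣ρ∣≡)))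

∂-∂ₛ : {K : Family n} → IsComplex K → {τ : Subset n} → K τ ≡ true → ∂ K (∂ₛ K τ) ≐ ∅ᶠ
∂-∂ₛ {n} {K} K-complex {τ} Kτ ω = begin
  xorSum S (λ ρ → ∂ₛ K τ ρ ∧ ∂ₛ K ρ ω)
    ≡⟨ xorSum-cong S (λ ρ → ∂ₛ-∂ₛ K-complex Kτ ρ ω) ⟩
  xorSum S (λ ρ → K ω ∧ (layer ω τ (suc ∣ ω ∣) ρ ∧ sizes))
    ≡⟨ xorSum-∧ˡ S (K ω) _ ⟩
  K ω ∧ xorSum S (λ ρ → layer ω τ (suc ∣ ω ∣) ρ ∧ sizes)
    ≡⟨ cong (K ω ∧_) (xorSum-∧ʳ S sizes _) ⟩
  K ω ∧ (xorSum S (layer ω τ (suc ∣ ω ∣)) ∧ sizes)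
    ≡⟨ cong (λ b → K ω ∧ (b ∧ sizes)) (xorSum-layer ω τ (suc ∣ ω ∣)) ⟩
  K ω ∧ (layerParity ω τ (suc ∣ ω ∣) ∧ sizes)
    ≡⟨ cong (K ω ∧_) (vanishes sizes refl) ⟩
  K ω ∧ false
    ≡⟨ ∧-zeroʳ (K ω) ⟩
  false ∎
  where
  S = allSubsets n
  sizes = suc (suc ∣ ω ∣) ≡ᵇ ∣ τ ∣
  vanishes : ∀ b → b ≡ sizes → layerParity ω τ (suc ∣ ω ∣) ∧ b ≡ false
  vanishes false _  = ∧-zeroʳ _
  vanishes true  eq = cong (_∧ true) (layerParity-middle ω τ (sym (≡ᵇ≡true⇒≡ _ _ (sym eq))))

∂-∂ₛ∖ᶠ : {K : Family n} → IsComplex K → {σ τ : Subset n} → K τ ≡ true → ∂ₛ K τ σ ≡ true →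
         ∂ K (∂ₛ K τ ∖ᶠ σ) ≐ ∂ₛ K σ
∂-∂ₛ∖ᶠ {K = K} K-complex {σ} {τ} Kτ σ∈∂τ ρ = begin
  ∂ K (∂ₛ K τ ∖ᶠ σ) ρ
    ≡⟨ sym (xor-cancelʳ _ (∂ₛ K σ ρ)) ⟩
  (∂ K (∂ₛ K τ ∖ᶠ σ) ρ xor ∂ₛ K σ ρ) xor ∂ₛ K σ ρ
    ≡⟨ cong (_xor ∂ₛ K σ ρ) (cong (∂ K (∂ₛ K τ ∖ᶠ σ) ρ xor_) (sym (ext-singleton (∂ₛ K) σ ρ))) ⟩
  (∂ K (∂ₛ K τ ∖ᶠ σ) ρ xor ∂ K (singleton σ) ρ) xor ∂ₛ K σ ρ
    ≡⟨ cong (_xor ∂ₛ K σ ρ) (sym (ext-⊕ (∂ₛ K) (∂ₛ K τ ∖ᶠ σ) (singleton σ) ρ)) ⟩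
  ∂ K (∂ₛ K τ ∖ᶠ σ ⊕ᶠ singleton σ) ρ xor ∂ₛ K σ ρ
    ≡⟨ cong (_xor ∂ₛ K σ ρ) (ext-cong (∂ₛ K) (λ ν → sym (c≐c∖ᶠσ⊕ᶠσ {c = ∂ₛ K τ} σ∈∂τ ν)) ρ) ⟩
  ∂ K (∂ₛ K τ) ρ xor ∂ₛ K σ ρ
    ≡⟨ cong (_xor ∂ₛ K σ ρ) (∂-∂ₛ K-complex Kτ ρ) ⟩
  ∂ₛ K σ ρ ∎

free-face : {K : Family n} {σ τ : Subset n} → K σ ≡ true → σ ⊆ τ → ∣ τ ∣ ≡ suc ∣ σ ∣ →
            ∂ₛ K τ σ ≡ true
free-face Kσ σ⊆τ ∣τ∣≡ =
  cong₂ _∧_ Kσ (cong₂ _∧_ (⇒⌊⌋≡true {a? = _ ⊆? _} σ⊆τ) (≡⇒≡ᵇ≡true _ _ (sym ∣τ∣≡)))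

All : (Subset n → Set) → Family n → Set
All P L = ∀ σ → L σ ≡ true → P σ

All-∪ᶠ : {P : Subset n → Set} {L M : Family n} → All P L → All P M → All P (L ∪ᶠ M)
All-∪ᶠ {L = L} PL PM σ σ∈ with L σ in σ∈L
... | true  = PL σ σ∈L
... | false = PM σ σ∈

morse-induction : (P : Subset n → Set) {L : Family n} {ws : List (Step n)} → MorseSeqTo L ws →
  (∀ {L′} s → s ∈ ws → ValidStep L′ s → (L′ ∪ᶠ added s) ⊆ᶠ L → All P L′ → All P (added s)) →
  All P L
morse-induction P start                   _         σ ()
morse-induction P (step {L′} s seq valid) step-case =
  All-∪ᶠ P-L′ (step-case s (here refl) valid (λ _ ρ∈ → ρ∈) P-L′)
  where
  P-L′ : All P L′
  P-L′ = morse-induction P seq (λ s′ s′∈ valid′ ⊆L′ →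
           step-case s′ (there s′∈) valid′ (λ ρ → cong (_∨ added s ρ) ∘ ⊆L′ ρ))

added-expand : {σ τ ρ : Subset n} → added (expand σ τ) ρ ≡ true → ρ ≡ σ ⊎ ρ ≡ τ
added-expand {σ = σ} {ρ = ρ} ρ∈ with ρ ==ˢ σ in ρ=σ
... | true  = inj₁ (⌊⌋≡true⇒ ρ=σ)
... | false = inj₂ (⌊⌋≡true⇒ ρ∈)

expansion-face-earlier : {K L : Family n} → IsComplex K → {σ τ ρ : Subset n} →
  ValidStep L (expand σ τ) → (∂ₛ K τ ∖ᶠ σ) ρ ≡ true → L ρ ≡ true
expansion-face-earlier {K = K} {L} K-complex {σ} {τ} {ρ} (L′-complex , _ , _ , _ , L′τ , _) ρ∈ =
  trans (sym (∨-identityʳ (L ρ))) (subst (λ b → L ρ ∨ b ≡ true) (cong₂ _∨_ ρ≠σ ρ≠τ) L′ρ)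
  where
  ρ∈∂τ : ∂ₛ K τ ρ ≡ true
  ρ∈∂τ = proj₁ (∧≡true⇒ ρ∈)
  Kρ : K ρ ≡ true
  Kρ = proj₁ (∧≡true⇒ ρ∈∂τ)
  ρ⊆τ : ρ ⊆ τ
  ρ⊆τ = ⌊⌋≡true⇒ {a? = ρ ⊆? τ} (proj₁ (∧≡true⇒ (proj₂ (∧≡true⇒ {K ρ} ρ∈∂τ))))
  ∣τ∣≡ : suc ∣ ρ ∣ ≡ ∣ τ ∣
  ∣τ∣≡ = ≡ᵇ≡true⇒≡ _ _ (proj₂ (∧≡true⇒ {ρ ⊆ᵇ τ} (proj₂ (∧≡true⇒ {K ρ} ρ∈∂τ))))
  L′ρ : L ρ ∨ ((ρ ==ˢ σ) ∨ (ρ ==ˢ τ)) ≡ true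
  L′ρ = IsComplex.closed L′-complex ρ τ L′τ (IsComplex.nonempty K-complex ρ Kρ) ρ⊆τ
  ρ≠σ : (ρ ==ˢ σ) ≡ false
  ρ≠σ = not-injective (proj₂ (∧≡true⇒ ρ∈))
  ρ≠τ : (ρ ==ˢ τ) ≡ false
  ρ≠τ = ⇒⌊⌋≡false (λ ρ≡τ → 1+n≢n (subst (λ ν → suc ∣ ν ∣ ≡ ∣ τ ∣) ρ≡τ ∣τ∣≡))

module MorseReference {n : ℕ} {K : Family n} (K-complex : IsComplex K) (W : MorseSequence K)
         {Υ : Frame n} (Υ-reference : IsMorseReference W Υ) where
  open IsMorseReference Υ-reference
  open MorseSequence W using (steps; seq; isK)

  ∂ᴹ : Frame n
  ∂ᴹ ν = ext Υ (∂ₛ K ν)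

  Commutes : Subset n → Set
  Commutes σ = ∂ᴹ σ ≐ ext ∂ᴹ (Υ σ)

  critical-commutes : {σ : Subset n} → Critical W σ → Commutes σ
  critical-commutes {σ} σ-critical ω =
    sym (trans (ext-cong ∂ᴹ (critical σ σ-critical) ω) (ext-singleton ∂ᴹ σ ω))

  coface-commutes : {σ τ : Subset n} → RegularPair W σ τ → ∂ₛ K τ σ ≡ true → Commutes τ
  coface-commutes {σ} {τ} regular σ∈∂τ ω = begin
    ∂ᴹ τ ω
      ≡⟨ ext-cong Υ (c≐c∖ᶠσ⊕ᶠσ {c = ∂ₛ K τ} σ∈∂τ) ω ⟩
    ext Υ (∂ₛ K τ ∖ᶠ σ ⊕ᶠ singleton σ) ω
      ≡⟨ ext-⊕ Υ (∂ₛ K τ ∖ᶠ σ) (singleton σ) ω ⟩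
    ext Υ (∂ₛ K τ ∖ᶠ σ) ω xor ext Υ (singleton σ) ω
      ≡⟨ cong₂ _xor_ (sym (regularσ σ τ regular ω)) (ext-singleton Υ σ ω) ⟩
    Υ σ ω xor Υ σ ω
      ≡⟨ xor-same (Υ σ ω) ⟩
    false
      ≡⟨ sym (trans (ext-cong ∂ᴹ (regularτ σ τ regular) ω) (ext-∅ ∂ᴹ ω)) ⟩
    ext ∂ᴹ (Υ τ) ω ∎

  face-commutes : {σ τ : Subset n} → RegularPair W σ τ → ∂ₛ K τ σ ≡ true → K τ ≡ true →
                  All Commutes (∂ₛ K τ ∖ᶠ σ) → Commutes σ
  face-commutes {σ} {τ} regular σ∈∂τ Kτ faces-commute ω = begin
    ∂ᴹ σ ω
      ≡⟨ ext-cong Υ (λ ρ → sym (∂-∂ₛ∖ᶠ K-complex Kτ σ∈∂τ ρ)) ω ⟩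
    ext Υ (∂ K (∂ₛ K τ ∖ᶠ σ)) ω
      ≡⟨ ext-∘ (∂ₛ K) Υ (∂ₛ K τ ∖ᶠ σ) ω ⟩
    ext ∂ᴹ (∂ₛ K τ ∖ᶠ σ) ω
      ≡⟨ ext-cong-on (∂ₛ K τ ∖ᶠ σ) faces-commute ω ⟩
    ext (ext ∂ᴹ ∘ Υ) (∂ₛ K τ ∖ᶠ σ) ω
      ≡⟨ sym (ext-∘ Υ ∂ᴹ (∂ₛ K τ ∖ᶠ σ) ω) ⟩
    ext ∂ᴹ (ext Υ (∂ₛ K τ ∖ᶠ σ)) ω
      ≡⟨ sym (ext-cong ∂ᴹ (regularσ σ τ regular) ω) ⟩
    ext ∂ᴹ (Υ σ) ω ∎

  step-commutes : ∀ {L} s → s ∈ steps → ValidStep L s → (L ∪ᶠ added s) ⊆ᶠ K →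
                  All Commutes L → All Commutes (added s)
  step-commutes (fill ν) s∈ _ _ _ σ σ∈ rewrite ⌊⌋≡true⇒ {a? = ≡-dec _≟_ σ ν} σ∈ =
    critical-commutes s∈
  step-commutes (expand ν τ) s∈ valid@(_ , _ , _ , L′ν , L′τ , ν⊆τ , ∣τ∣≡ , _) ⊆K L-commutes σ σ∈
    with added-expand {σ = ν} {τ} {σ} σ∈
  ... | inj₁ refl = face-commutes s∈ (free-face {K = K} (⊆K ν L′ν) ν⊆τ ∣τ∣≡) (⊆K τ L′τ)
                      (λ ρ ρ∈ → L-commutes ρ (expansion-face-earlier K-complex valid ρ∈))
  ... | inj₂ refl = coface-commutes s∈ (free-face {K = K} (⊆K ν L′ν) ν⊆τ ∣τ∣≡)

  commutes : All Commutes K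
  commutes σ Kσ =
    morse-induction Commutes seq
      (λ s s∈ valid ⊆final → step-commutes s s∈ valid (λ ρ → trans (sym (isK ρ)) ∘ ⊆final ρ))
      σ (trans (isK σ) Kσ)

  Υ∂≐∂ᴹΥ : {c : Family n} → c ⊆ᶠ K → ext Υ (∂ K c) ≐ ext ∂ᴹ (ext Υ c)
  Υ∂≐∂ᴹΥ {c} c⊆K ω = begin
    ext Υ (∂ K c) ω      ≡⟨ ext-∘ (∂ₛ K) Υ c ω ⟩
    ext ∂ᴹ c ω           ≡⟨ ext-cong-on c (λ σ → commutes σ ∘ c⊆K σ) ω ⟩
    ext (ext ∂ᴹ ∘ Υ) c ω ≡⟨ ext-∘ Υ ∂ᴹ c ω ⟨
    ext ∂ᴹ (ext Υ c) ω   ∎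

proposition2 : {n : ℕ} (K : Family n) → IsComplex K →
    (W : MorseSequence K) (Υ : Frame n) → IsMorseReference W Υ →
    (p : ℕ) (c c' : Family n) → IsChain K p c → IsChain K p c' →
    ext Υ c ≐ ext Υ c' → ext Υ (∂ K c) ≐ ext Υ (∂ K c')
proposition2 K K-complex W Υ Υ-reference p c c′ c∈K[p] c′∈K[p] Υc≐Υc′ ω = begin
  ext Υ (∂ K c) ω     ≡⟨ Υ∂≐∂ᴹΥ (λ σ → proj₁ ∘ c∈K[p] σ) ω ⟩
  ext ∂ᴹ (ext Υ c) ω  ≡⟨ ext-cong ∂ᴹ Υc≐Υc′ ω ⟩
  ext ∂ᴹ (ext Υ c′) ω ≡⟨ Υ∂≐∂ᴹΥ (λ σ → proj₁ ∘ c′∈K[p] σ) ω ⟨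
  ext Υ (∂ K c′) ω    ∎
  where open MorseReference K-complex W Υ-reference
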